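{- Let $G$ be a graph with a universal vertex $u$. Then every vertex $v\neq u$ of $G$ belongs to every MEG-set of $G$. In particular, if $G$ has $n$ vertices, then $meg(G)\geq n-1$.
   Context: All graphs are finite and simple. A universal vertex is a vertex adjacent to all other vertices. A pair of vertices $u,v$ (or any vertex set containing them) monitors an edge $e$ if $e$ lies on every shortest $u$–$v$ path. A monitoring edge-geodetic set (MEG-set) of $G$ is a set $M\subseteq V(G)$ such that every edge of $G$ is monitored by some pair of vertices of $M$; $meg(G)$ is the minimum size of an MEG-set. -}

module Defs where

open import Level using (0ℓ)
open import Data.Nat using (ℕ; zero; suc; _≤_)
open import Data.Fin using (Fin)
open import Data.Fin.Subset using (Subset; _∈_)
open import Data.Product using (_×_; ∃-syntax)
open import Data.Sum using (_⊎_)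
open import Data.Empty using (⊥)
open import Relation.Binary.PropositionalEquality using (_≡_; _≢_)

record Graph : Set₁ where
  field
    n      : ℕ
    Adj    : Fin n → Fin n → Set
    sym    : ∀ {x y} → Adj x y → Adj y x
    irrefl : ∀ {x} → Adj x x → ⊥

module _ (G : Graph) where
  open Graph G

  data Walk : Fin n → Fin n → Set where
    []  : ∀ {x} → Walk x x
    _∷_ : ∀ {x y z} → Adj x y → Walk y z → Walk x z

  len : ∀ {x z} → Walk x z → ℕ
  len []      = zero
  len (_ ∷ w) = suc (len w)

  -- a shortest x–z path: a walk of minimum length among all x–z walks
  -- (such a walk is automatically a path)
  IsShortest : ∀ {x z} → Walk x z → Set
  IsShortest {x} {z} w = ∀ (w' : Walk x z) → len w ≤ len w'

  UsesEdge : Fin n → Fin n → ∀ {x z} → Walk x z → Set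
  UsesEdge a b []                  = ⊥
  UsesEdge a b (_∷_ {x} {y} _ w)   =
    ((x ≡ a × y ≡ b) ⊎ (x ≡ b × y ≡ a)) ⊎ UsesEdge a b w

  Monitors : Fin n → Fin n → Fin n → Fin n → Set
  Monitors x y a b = ∀ (w : Walk x y) → IsShortest w → UsesEdge a b w

  IsMEG : Subset n → Set
  IsMEG M = ∀ a b → Adj a b →
    ∃[ x ] ∃[ y ] (x ∈ M × y ∈ M × Monitors x y a b)

  Universal : Fin n → Set
  Universal u = ∀ v → v ≢ u → Adj u v

{-# OPTIONS --safe #-}
module Submission where

-- An edge u v at a universal vertex u must be monitored by some pair x, y of the set. If v were
-- neither x nor y, that pair could not monitor it: for x = y the empty walk is shortest, for
-- adjacent x, y the edge x y is the only shortest path, and otherwise x, y ≠ u and x u y is a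
-- shortest path avoiding u v.

open import Defs
open import Data.Nat using (_≤_; _∸_; s≤s; z≤n)
open import Data.Fin using (Fin; _≟_)
open import Data.Fin.Subset using (Subset; _∈_; ∣_∣; ∁; ⁅_⁆)
open import Data.Fin.Subset.Properties
  using (_∈?_; x∈∁p⇒x∉p; x∈⁅x⁆; p⊆q⇒∣p∣≤∣q∣; ∣∁p∣≡n∸∣p∣; ∣⁅x⁆∣≡1)
open import Data.Product using (_×_; _,_)
open import Data.Sum using (_⊎_; inj₁; inj₂)
open import Data.Empty using (⊥-elim)
open import Function using (_∘_)
open import Relation.Nullary using (¬_; yes; no)
open import Relation.Binary.PropositionalEquality
  using (_≡_; _≢_; refl; sym; cong; subst; module ≡-Reasoning)

module _ (G : Graph) where
  open Graph G renaming (sym to Adj-sym)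

  ¬Monitors-self : ∀ {x a b} → ¬ Monitors G x x a b
  ¬Monitors-self mon = mon [] (λ _ → z≤n)

  edge-isShortest : ∀ {x y} (e : Adj x y) → IsShortest G (e ∷ [])
  edge-isShortest e []      = ⊥-elim (irrefl e)
  edge-isShortest e (_ ∷ _) = s≤s z≤n

  Monitors-adjacent : ∀ {x y a b} → Adj x y → Monitors G x y a b →
                      (x ≡ a × y ≡ b) ⊎ (x ≡ b × y ≡ a)
  Monitors-adjacent e mon with mon (e ∷ []) (edge-isShortest e)
  ... | inj₁ endpoints = endpoints

  twoStep-isShortest : ∀ {x y z} → x ≢ y → ¬ Adj x y →
                       (e : Adj x z) (f : Adj z y) → IsShortest G (e ∷ (f ∷ []))
  twoStep-isShortest x≢y ¬xy e f []            = ⊥-elim (x≢y refl)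
  twoStep-isShortest x≢y ¬xy e f (g ∷ [])      = ⊥-elim (¬xy g)
  twoStep-isShortest x≢y ¬xy e f (_ ∷ (_ ∷ _)) = s≤s (s≤s z≤n)

  module _ {u : Fin n} (univ : Universal G u) where

    ¬Monitors-spoke : ∀ {v x y} → v ≢ u → v ≢ x → v ≢ y → ¬ Monitors G x y u v
    ¬Monitors-spoke {v} {x} {y} v≢u v≢x v≢y mon with x ≟ y
    ... | yes refl = ¬Monitors-self mon
    ... | no x≢y   = nonadjacent adjacent
      where
      -- Adj is not decidable, but the goal is ⊥, so refuting both Adj x y and ¬ Adj x y suffices.
      adjacent : ¬ Adj x y
      adjacent e with Monitors-adjacent e mon
      ... | inj₁ (_ , y≡v) = v≢y (sym y≡v)
      ... | inj₂ (x≡v , _) = v≢x (sym x≡v)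

      nonadjacent : ¬ ¬ Adj x y
      nonadjacent ¬xy = avoids (mon (ux ∷ (uy ∷ [])) (twoStep-isShortest x≢y ¬xy ux uy))
        where
        x≢u : x ≢ u
        x≢u refl = ¬xy (univ y (x≢y ∘ sym))
        y≢u : y ≢ u
        y≢u refl = ¬xy (Adj-sym (univ x x≢y))
        ux : Adj x u
        ux = Adj-sym (univ x x≢u)
        uy : Adj u y
        uy = univ y y≢u
        avoids : ¬ UsesEdge G u v (ux ∷ (uy ∷ []))
        avoids (inj₁ (inj₁ (x≡u , _)))        = x≢u x≡u
        avoids (inj₁ (inj₂ (x≡v , _)))        = v≢x (sym x≡v)
        avoids (inj₂ (inj₁ (inj₁ (_ , y≡v)))) = v≢y (sym y≡v)
        avoids (inj₂ (inj₁ (inj₂ (_ , y≡u)))) = y≢u y≡u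

    IsMEG⇒nonUniversal∈ : ∀ {M} → IsMEG G M → ∀ v → v ≢ u → v ∈ M
    IsMEG⇒nonUniversal∈ {M} meg v v≢u with v ∈? M
    ... | yes v∈M = v∈M
    ... | no v∉M with meg u v (univ v v≢u)
    ... | x , y , x∈M , y∈M , mon =
      ⊥-elim (¬Monitors-spoke v≢u (λ { refl → v∉M x∈M }) (λ { refl → v∉M y∈M }) mon)

all-but-one⇒n∸1≤∣p∣ : ∀ {n} {u : Fin n} (p : Subset n) → (∀ v → v ≢ u → v ∈ p) → n ∸ 1 ≤ ∣ p ∣
all-but-one⇒n∸1≤∣p∣ {n} {u} p contains = subst (_≤ ∣ p ∣) ∣∁⁅u⁆∣≡n∸1 (p⊆q⇒∣p∣≤∣q∣ ∁⁅u⁆⊆p)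
  where
  ∁⁅u⁆⊆p : ∀ {v} → v ∈ ∁ ⁅ u ⁆ → v ∈ p
  ∁⁅u⁆⊆p {v} v∈∁ = contains v (λ { refl → x∈∁p⇒x∉p v∈∁ (x∈⁅x⁆ u) })

  ∣∁⁅u⁆∣≡n∸1 : ∣ ∁ ⁅ u ⁆ ∣ ≡ n ∸ 1
  ∣∁⁅u⁆∣≡n∸1 = begin
    ∣ ∁ ⁅ u ⁆ ∣     ≡⟨ ∣∁p∣≡n∸∣p∣ ⁅ u ⁆ ⟩
    n ∸ ∣ ⁅ u ⁆ ∣   ≡⟨ cong (n ∸_) (∣⁅x⁆∣≡1 u) ⟩
    n ∸ 1           ∎
    where open ≡-Reasoning

mainTheorem19 : (G : Graph) (u : Fin (Graph.n G)) → Universal G u →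
    ((M : Subset (Graph.n G)) → IsMEG G M → (v : Fin (Graph.n G)) → v ≢ u → v ∈ M)
    × ((M : Subset (Graph.n G)) → IsMEG G M → Graph.n G ∸ 1 ≤ ∣ M ∣)
mainTheorem19 G u univ =
    (λ M → IsMEG⇒nonUniversal∈ G univ)
  , (λ M meg → all-but-one⇒n∸1≤∣p∣ M (IsMEG⇒nonUniversal∈ G univ meg))
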